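{- Let $n\geq1$ and consider the normed BPA system $\Delta_0$ described in the context. Let $\alpha$ be a process with $\mathrm{Var}(\alpha)\subseteq\mathcal{B}$ and let $b_1,\dots,b_n\in\{0,1\}$. Then $\alpha\in\mathrm{Enc}(b_nb_{n-1}\dots b_1)$ if and only if $\mathrm{Rd}(\alpha)=\{Z_1^{b_1},Z_2^{b_2},\dots,Z_n^{b_n}\}$.
   Context: BPA systems: a BPA system $(\mathcal{V},\mathcal{A},\mathcal{R})$ has finite sets of variables, actions (containing the internal action $\tau$) and rules $X\xrightarrow{\lambda}\alpha$; processes are words over $\mathcal{V}$; if $X\xrightarrow{\lambda}\alpha$ is a rule then $X\beta\xrightarrow{\lambda}\alpha\beta$. Write $\to$ for $\xrightarrow{\tau}$, $\Rightarrow$ for its reflexive transitive closure, $\mathrm{Var}(\alpha)$ for the set of variables occurring in $\alpha$. A symmetric relation $R$ is a branching bisimulation if whenever $\alpha R\beta$ and $\alpha\xrightarrow{\lambda}\alpha'$, either ($\lambda=\tau$ and $\alpha'R\beta$) or $\beta\Rightarrow\beta''\xrightarrow{\lambda}\beta'$ with $\alpha R\beta''$ and $\alpha'R\beta'$; $\simeq$ is the largest branching bisimulation. The redundant set of $\alpha$ is $\mathrm{Rd}(\alpha)=\{X\in\mathcal{V}\mid X\alpha\simeq\alpha\}$. The system $\Delta_0$: variables $\mathcal{V}=\mathcal{B}\uplus\mathcal{B}'$ with $\mathcal{B}=\{B_i^0,B_i^1\mid 1\le i\le n\}$ and $\mathcal{B}'=\{Z_i^0,Z_i^1\mid 1\le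 i\le n\}\cup\{B_i^b(j,b')\mid 1\le i,j\le n,\ i\ne j,\ b,b'\in\{0,1\}\}$; actions $\{d,\tau\}\cup\{a_i^0,a_i^1\mid 1\le i\le n\}$; rules, for all $1\le i,j,j'\le n$ and $b,b',b''\in\{0,1\}$: $Z_i^b\xrightarrow{a_i^b}\epsilon$, $Z_i^b\xrightarrow{\tau}\epsilon$; $B_i^b\xrightarrow{a_i^b}B_i^b$, $B_i^b\xrightarrow{d}\epsilon$, $B_i^b\xrightarrow{a_j^{b'}}B_i^b(j,b')$ for $j\ne i$; $B_i^b(j,b')\xrightarrow{a_i^b}B_i^b(j,b')$, $B_i^b(j,b')\xrightarrow{d}Z_j^{b'}$, $B_i^b(j,b')\xrightarrow{a_{j'}^{b''}}B_i^b(j',b'')$ for $j\ne i$, $j'\ne i$. Encoding: $\alpha\in\mathrm{Enc}(b_nb_{n-1}\dots b_1)$ means $\mathrm{Var}(\alpha)\subseteq\mathcal{B}$ and for every $1\le i\le n$ there are processes $\alpha_{i_1},\alpha_{i_2}$ with $\alpha=\alpha_{i_1}B_i^{b_i}\alpha_{i_2}$ and $B_i^{1-b_i}\notin\mathrm{Var}(\alpha_{i_1})$. -}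

module Defs where

open import Data.Nat using (ℕ)
open import Data.Fin using (Fin)
open import Data.Bool using (Bool; not)
open import Data.List using (List; []; _∷_; _++_)
open import Data.List.Membership.Propositional using (_∈_)
open import Data.List.Relation.Unary.All using (All)
open import Data.Product using (Σ; ∃; _×_; ∃-syntax)
open import Data.Sum using (_⊎_)
open import Relation.Nullary using (¬_)
open import Relation.Binary.PropositionalEquality using (_≡_; _≢_)
open import Relation.Binary.Construct.Closure.ReflexiveTransitive using (Star)
open import Level using (0ℓ)
open import Function.Bundles using (_⇔_)

-- Indices 1..n are represented by Fin n (index i stands for i+1); bits by Bool.

data Var (n : ℕ) : Set where
  B  : (i : Fin n) (b : Bool) → Var n
  Z  : (i : Fin n) (b : Bool) → Var n
  BB : (i : Fin n) (b : Bool) (j : Fin n) (b' : Bool) → i ≢ j → Var n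

data IsB {n : ℕ} : Var n → Set where
  isB : ∀ i b → IsB (B i b)

data Act (n : ℕ) : Set where
  d : Act n
  τ : Act n
  a : (i : Fin n) (b : Bool) → Act n

Process : ℕ → Set
Process n = List (Var n)

data Rule {n : ℕ} : Var n → Act n → Process n → Set where
  Z-a   : ∀ i b → Rule (Z i b) (a i b) []
  Z-τ   : ∀ i b → Rule (Z i b) τ []
  B-a   : ∀ i b → Rule (B i b) (a i b) (B i b ∷ [])
  B-d   : ∀ i b → Rule (B i b) d []
  B-aj  : ∀ i b j b' (i≢j : i ≢ j) → Rule (B i b) (a j b') (BB i b j b' i≢j ∷ [])
  BB-a  : ∀ i b j b' (i≢j : i ≢ j) → Rule (BB i b j b' i≢j) (a i b) (BB i b j b' i≢j ∷ [])
  BB-d  : ∀ i b j b' (i≢j : i ≢ j) → Rule (BB i b j b' i≢j) d (Z j b' ∷ [])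
  BB-aj : ∀ i b j b' (i≢j : i ≢ j) j' b'' (i≢j' : i ≢ j') →
          Rule (BB i b j b' i≢j) (a j' b'') (BB i b j' b'' i≢j' ∷ [])

data Step {n : ℕ} : Process n → Act n → Process n → Set where
  step : ∀ {X λ' α} β → Rule X λ' α → Step (X ∷ β) λ' (α ++ β)

_⇒_ : ∀ {n} → Process n → Process n → Set
_⇒_ {n} = Star (λ α β → Step {n} α τ β)

record IsBranchingBisim {n : ℕ} (R : Process n → Process n → Set) : Set where
  field
    sym  : ∀ {α β} → R α β → R β α
    move : ∀ {α β α' λ'} → R α β → Step α λ' α' →
           (λ' ≡ τ × R α' β)
           ⊎ (∃[ β'' ] ∃[ β' ] (β ⇒ β'' × Step β'' λ' β' × R α β'' × R α' β'))

_≃_ : ∀ {n} → Process n → Process n → Set₁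
_≃_ {n} α β = Σ (Process n → Process n → Set) λ R → IsBranchingBisim R × R α β

Rd : ∀ {n} → Process n → Var n → Set₁
Rd α X = (X ∷ α) ≃ α

Enc : ∀ {n} → (Fin n → Bool) → Process n → Set
Enc {n} bs α =
  All IsB α ×
  ((i : Fin n) → ∃[ α₁ ] ∃[ α₂ ]
     (α ≡ α₁ ++ (B i (bs i) ∷ α₂) × ¬ (B i (not (bs i)) ∈ α₁)))

module Submission where

open import Defs
open import Data.Nat using (ℕ; _≤_)
open import Data.Fin using (Fin; _≟_)
open import Data.Bool using (Bool; not)
open import Data.Bool.Properties using (¬-not) renaming (_≟_ to _≟ᵇ_)
open import Data.List using ([]; _∷_; _++_)
open import Data.List.Relation.Unary.All using (All; _∷_)
open import Data.List.Relation.Unary.All.Properties using (++⁻ˡ)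
open import Data.List.Relation.Unary.Any using (here; there)
open import Data.List.Membership.Propositional using (_∈_)
open import Data.Product using (∃-syntax; _×_; _,_)
open import Data.Sum using (_⊎_; inj₁; inj₂)
open import Data.Empty using (⊥-elim)
open import Relation.Nullary using (¬_; yes; no; contradiction)
open import Relation.Binary.PropositionalEquality using (_≡_; _≢_; refl; cong)
import Relation.Binary.PropositionalEquality as ≡
open import Relation.Binary.Construct.Closure.ReflexiveTransitive using (ε; _◅_)
open import Function.Bundles using (_⇔_; mk⇔; Equivalence)

-- Z_i^b is redundant in front of α exactly when the first B_i-variable of α is B_i^b.
-- If so, the τ of Z_i^b is inert and its a_i^b is answered by the head of α: either
-- by the loop of B_i^b, or by B_j^c --a_i^b--> B_j^c(i,b), whose d-step re-exposes
-- Z_i^b in front of the tail. Conversely, a bisimulation answering a_i^b from Z_i^b α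
-- must take one of these two steps (α has no τ-steps), and the second leads by d to
-- the same question for the tail. A variable B_j^c in front of α is never redundant:
-- its d-step can only be answered by the d-step of the head of α, which reduces to the
-- same question for the tail; B_j^c(k,e) reduces to that case via its d-step and the inert
-- τ of Z_k^e.

open IsBranchingBisim

private
  variable
    n : ℕ
    i j k : Fin n
    b c e : Bool
    α β α' : Process n
    λ' : Act n

data FirstBit (i : Fin n) (b : Bool) : Process n → Set where
  first : FirstBit i b (B i b ∷ α)
  skip  : j ≢ i → FirstBit i b α → FirstBit i b (B j c ∷ α)

firstBit-unique : FirstBit i b α → FirstBit i c α → b ≡ c
firstBit-unique first        first        = refl
firstBit-unique first        (skip j≢i _) = contradiction refl j≢i
firstBit-unique (skip j≢i _) first        = contradiction refl j≢i
firstBit-unique (skip _ f)   (skip _ g)   = firstBit-unique f g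

firstBit-split : FirstBit i b α →
  ∃[ α₁ ] ∃[ α₂ ] (α ≡ α₁ ++ (B i b ∷ α₂) × ¬ (B i (not b) ∈ α₁))
firstBit-split {α = _ ∷ α} first = [] , α , refl , λ ()
firstBit-split {α = B j c ∷ _} (skip j≢i f) with firstBit-split f
... | α₁ , α₂ , refl , ∉α₁ = B j c ∷ α₁ , α₂ , refl , λ
  { (here refl) → j≢i refl
  ; (there ∈α₁) → ∉α₁ ∈α₁
  }

split-firstBit : ∀ α₁ α₂ → All IsB α₁ → ¬ (B i (not b) ∈ α₁) →
  FirstBit i b (α₁ ++ (B i b ∷ α₂))
split-firstBit [] _ _ _ = first
split-firstBit {i = i} {b} (B j c ∷ α₁) α₂ (isB j c ∷ allB) ∉α₁ with j ≟ i
... | no j≢i = skip j≢i (split-firstBit α₁ α₂ allB (λ ∈α₁ → ∉α₁ (there ∈α₁)))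
... | yes refl with c ≟ᵇ b
...   | yes refl = first
...   | no c≢b   = contradiction (here (cong (B i) (≡.sym (¬-not c≢b)))) ∉α₁

Enc⇔FirstBit : (bs : Fin n → Bool) → All IsB α →
  Enc bs α ⇔ ((i : Fin n) → FirstBit i (bs i) α)
Enc⇔FirstBit {α = α} bs allB = mk⇔
  (λ (_ , split) i → from-split (split i))
  (λ firsts → allB , λ i → firstBit-split (firsts i))
  where
  from-split : ∃[ α₁ ] ∃[ α₂ ] (α ≡ α₁ ++ (B i b ∷ α₂) × ¬ (B i (not b) ∈ α₁)) →
    FirstBit i b α
  from-split (α₁ , α₂ , refl , ∉α₁) = split-firstBit α₁ α₂ (++⁻ˡ α₁ allB) ∉α₁

IsB-τ-free : All IsB α → ¬ Step α τ α'
IsB-τ-free (isB _ _ ∷ _) (step _ ())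

module _ {R : Process n → Process n → Set} (bis : IsBranchingBisim R) where

  match-τ-free : R α β → All IsB β → Step α λ' α' →
    (λ' ≡ τ × R α' β) ⊎ ∃[ β' ] (Step β λ' β' × R α' β')
  match-τ-free r allB s with move bis r s
  ... | inj₁ stutter                    = inj₁ stutter
  ... | inj₂ (_ , β' , ε , s' , _ , r') = inj₂ (β' , s' , r')
  ... | inj₂ (_ , _ , t ◅ _ , _)        = contradiction t (IsB-τ-free allB)

  redundant-Z⇒FirstBit : ∀ α → All IsB α → R (Z i b ∷ α) α → FirstBit i b α
  redundant-Z⇒FirstBit {i} {b} α allB r with match-τ-free r allB (step α (Z-a i b))
  redundant-Z⇒FirstBit (B _ _ ∷ α) (isB _ _ ∷ _) _ | inj₂ (_ , step _ (B-a _ _) , _) = first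
  redundant-Z⇒FirstBit (B j c ∷ α) allB@(isB _ _ ∷ allB′) _
    | inj₂ (_ , step _ (B-aj _ _ i b j≢i) , r')
    with match-τ-free (sym bis r') allB (step α (BB-d j c i b j≢i))
  ... | inj₂ (_ , step _ (B-d _ _) , r'') = skip j≢i (redundant-Z⇒FirstBit α allB′ r'')

  B-irredundant : ∀ α → All IsB α → ¬ R (B j c ∷ α) α
  B-irredundant {j} {c} α allB r with match-τ-free r allB (step α (B-d j c))
  B-irredundant (B k e ∷ α) (_ ∷ allB) r | inj₂ (_ , step _ (B-d _ _) , r') =
    B-irredundant α allB r'

  BB-irredundant : ∀ α → All IsB α → (j≢k : j ≢ k) → ¬ R (BB j c k e j≢k ∷ α) α
  BB-irredundant α allB j≢k r with match-τ-free r allB (step α (BB-d _ _ _ _ j≢k))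
  BB-irredundant (B _ _ ∷ α) (_ ∷ allB) _ r | inj₂ (_ , step _ (B-d _ _) , r')
    with match-τ-free r' allB (step _ (Z-τ _ _))
  ... | inj₁ (_ , r'') = B-irredundant α allB r''
  ... | inj₂ (_ , t , _) = contradiction t (IsB-τ-free allB)

data _∼_ : Process n → Process n → Set where
  ∼-refl : α ∼ α
  Z∼     : FirstBit i b α → (Z i b ∷ α) ∼ α
  ∼Z     : FirstBit i b α → α ∼ (Z i b ∷ α)
  B∼BB   : (j≢i : j ≢ i) → FirstBit i b α → (B j c ∷ α) ∼ (BB j c i b j≢i ∷ α)
  BB∼B   : (j≢i : j ≢ i) → FirstBit i b α → (BB j c i b j≢i ∷ α) ∼ (B j c ∷ α)

∼-sym : α ∼ β → β ∼ α
∼-sym ∼-refl         = ∼-refl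
∼-sym (Z∼ f)         = ∼Z f
∼-sym (∼Z f)         = Z∼ f
∼-sym (B∼BB j≢i f)   = BB∼B j≢i f
∼-sym (BB∼B j≢i f)   = B∼BB j≢i f

∼-move : α ∼ β → Step α λ' α' →
  (λ' ≡ τ × α' ∼ β) ⊎ ∃[ β'' ] ∃[ β' ] (β ⇒ β'' × Step β'' λ' β' × α ∼ β'' × α' ∼ β')
∼-move ∼-refl s = inj₂ (_ , _ , ε , s , ∼-refl , ∼-refl)
∼-move (Z∼ f) (step _ (Z-τ _ _)) = inj₁ (refl , ∼-refl)
∼-move (Z∼ first) (step (B i b ∷ α) (Z-a i b)) =
  inj₂ (_ , _ , ε , step α (B-a i b) , Z∼ first , ∼-refl)
∼-move (Z∼ (skip j≢i f)) (step (B j c ∷ α) (Z-a i b)) =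
  inj₂ (_ , _ , ε , step α (B-aj j c i b j≢i) , Z∼ (skip j≢i f) , B∼BB j≢i f)
∼-move (∼Z {i = i} {b = b} f) s = inj₂ (_ , _ , step _ (Z-τ i b) ◅ ε , s , ∼-refl , ∼-refl)
∼-move (B∼BB {i = i} {b = b} {α = α} j≢i f) (step _ (B-a j c)) =
  inj₂ (_ , _ , ε , step α (BB-a j c i b j≢i) , B∼BB j≢i f , B∼BB j≢i f)
∼-move (B∼BB {i = i} {b = b} {α = α} j≢i f) (step _ (B-d j c)) =
  inj₂ (_ , _ , ε , step α (BB-d j c i b j≢i) , B∼BB j≢i f , ∼Z f)
∼-move (B∼BB {i = i} {b = b} {α = α} j≢i f) (step _ (B-aj j c k e j≢k)) =
  inj₂ (_ , _ , ε , step α (BB-aj j c i b j≢i k e j≢k) , B∼BB j≢i f , ∼-refl)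
∼-move (BB∼B {α = α} j≢i f) (step _ (BB-a j c _ _ _)) =
  inj₂ (_ , _ , ε , step α (B-a j c) , BB∼B j≢i f , BB∼B j≢i f)
∼-move (BB∼B {α = α} j≢i f) (step _ (BB-d j c _ _ _)) =
  inj₂ (_ , _ , ε , step α (B-d j c) , BB∼B j≢i f , Z∼ f)
∼-move (BB∼B {α = α} j≢i f) (step _ (BB-aj j c _ _ _ k e j≢k)) =
  inj₂ (_ , _ , ε , step α (B-aj j c k e j≢k) , BB∼B j≢i f , ∼-refl)

∼-isBranchingBisim : IsBranchingBisim (_∼_ {n})
∼-isBranchingBisim = record { sym = ∼-sym ; move = ∼-move }

Rd-Z⇔FirstBit : All IsB α → Rd α (Z i b) ⇔ FirstBit i b α
Rd-Z⇔FirstBit {α = α} allB = mk⇔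
  (λ (_ , bis , r) → redundant-Z⇒FirstBit bis α allB r)
  (λ f → _∼_ , ∼-isBranchingBisim , Z∼ f)

proposition12 : (n : ℕ) → 1 ≤ n → (α : Process n) → All IsB α → (bs : Fin n → Bool) →
    Enc bs α ⇔ ((X : Var n) → Rd α X ⇔ (∃[ i ] X ≡ Z i (bs i)))
proposition12 n _ α allB bs = mk⇔ Rd-of-Enc Enc-of-Rd
  where
  firstBit⇔ : ∀ {i b} → Rd α (Z i b) ⇔ FirstBit i b α
  firstBit⇔ = Rd-Z⇔FirstBit allB
  Rd-of-Enc : Enc bs α → (X : Var n) → Rd α X ⇔ (∃[ i ] X ≡ Z i (bs i))
  Rd-of-Enc enc (Z j c) = mk⇔
    (λ r → j , cong (Z j) (firstBit-unique (Equivalence.to firstBit⇔ r) (firsts j)))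
    (λ { (i , refl) → Equivalence.from firstBit⇔ (firsts i) })
    where
    firsts : (i : Fin n) → FirstBit i (bs i) α
    firsts = Equivalence.to (Enc⇔FirstBit bs allB) enc
  Rd-of-Enc _ (B j c) =
    mk⇔ (λ (_ , bis , r) → ⊥-elim (B-irredundant bis α allB r)) λ ()
  Rd-of-Enc _ (BB j c k e j≢k) =
    mk⇔ (λ (_ , bis , r) → ⊥-elim (BB-irredundant bis α allB j≢k r)) λ ()
  Enc-of-Rd : ((X : Var n) → Rd α X ⇔ (∃[ i ] X ≡ Z i (bs i))) → Enc bs α
  Enc-of-Rd rd = Equivalence.from (Enc⇔FirstBit bs allB)
    λ i → Equivalence.to firstBit⇔ (Equivalence.from (rd (Z i (bs i))) (i , refl))
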